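{- Let $c>0$. There exists a positive constant $F(c)$ with $\lim_{c\rightarrow 0^{+}}F(c) = 0$ such that, if $X$ is sufficiently large ($X \geq N_{c}$) and $\alpha,\beta$ are coprime integers with $\alpha$ even and \[ 1\leq \beta \leq \alpha \leq c\cdot X^{1/6}, \] then \[ \mathbf{S}_{c}(\alpha,\beta,X) \subset \mathcal{R}_{\theta,1}(F(c)\cdot X^{1/2},\infty). \]
   Context: Let $\mathbf{p}(x) = x^3+a_{2}x^2+a_{1}x+a_{0} \in \mathbb{Z}[x]$ be an irreducible cubic polynomial with $a_{2}^2-a_{1}$ even and $a_{1}a_{2}-a_{0}$ odd, and let $\theta$ be a root of $\mathbf{p}$. For $c_{0}+c_{1}\theta+c_{2}\theta^2 \in \mathbb{Z}[\theta]$ (with $c_j\in\mathbb{Z}$) put $M_{\theta}(c_{0}+c_{1}\theta+c_{2}\theta^2) = \max\{|c_{0}|,|c_{1}|,|c_{2}|\}$. For $Y_{1},Y_{2}\in[0,\infty]$ and $q\in\mathbb{N}$ let \[ \mathcal{R}_{\theta,q}(Y_{1},Y_{2}) = \{(\omega_{1},\omega_{2}) : \omega_{i}\in \mathbb{Z}[\theta],\ M_{\theta}(\omega_{i}) \leq Y_{1},\ \exists n \in \mathbb{Z},\ |n| \leq Y_{2},\ \omega_{1}^2+\omega_{2}^2 = q^2(n-\theta)\}. \] For integers $u_1,u_2,v_1,v_2$ define $I(u_{1},u_{2},v_{1},v_{2}) = u_{1}v_{2}-v_{1}u_{2}$, \[ h_{1}(u_{1},u_{2},v_{1},v_{2}) =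 -1+2a_{1}u_{1}u_{2}-u_{2}^2(a_{1}a_{2}-a_{0})+2a_{1}v_{1}v_{2}-v_{2}^2(a_{1}a_{2}-a_{0}), \] \[ h_{2}(u_{1},u_{2},v_{1},v_{2}) = -u_{1}^2+2a_{2}u_{1}u_{2}-u_{2}^2(a_{2}^2-a_{1}) -v_{1}^2+2a_{2}v_{1}v_{2}-v_{2}^2(a_{2}^2-a_{1}), \] $U_{0} = v_{2} h_{1}/2 - v_{1} h_{2}/2$ and $V_{0} = -u_{2} h_{1}/2 +u_{1}h_{2}/2$ (all evaluated at $(u_{1},u_{2},v_{1},v_{2})$). Let $\mathbf{S} \subset \mathbb{Z}[\theta]\times\mathbb{Z}[\theta]$ be the set of pairs $((u_{0}+u_{1}\theta+u_{2}\theta^2), (v_{0}+v_{1}\theta+v_{2}\theta^2))$ with integers $u_i,v_i$ such that: $v_{2}$ is even and $\gcd(u_{2},v_{2}) = 1$; $u_{1}$ and $v_{1}$ are odd with $I(u_{1},u_{2},v_{1},v_{2}) = 1$; and $u_{0} = U_{0}(u_{1},u_{2},v_{1},v_{2})$, $v_{0} = V_{0}(u_{1},u_{2},v_{1},v_{2})$. For coprime integers $\alpha,\beta$ with $\alpha$ even, fix odd integers $\mathbf{u}(\alpha,\beta)$, $\mathbf{v}(\alpha,\beta)$ with $\mathbf{u}(\alpha,\beta)\alpha - \mathbf{v}(\alpha,\beta)\beta = 1$. For $c>0$ and $X>0$ define $\mathbf{S}_{c}(\alpha,\beta,X)$ as the set of elements $((u_{0}+u_{1}\theta+u_{2}\theta^2),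 (v_{0}+v_{1}\theta+v_{2}\theta^2))$ of $\mathbf{S}$ with $v_{2} = \alpha$, $u_{2}=\beta$, $|v_{1}| \leq c\cdot X^{1/6}$ and $v_{1}\equiv \mathbf{v}(\alpha,\beta) \pmod{2\alpha}$.
   Formalization: The parameters c and X range over the positive rationals, and the constants F(c) and $N_{c}$ are taken in ℚ. -}

module Defs where

open import Data.Nat using (ℕ; zero; suc)
open import Data.Integer as ℤ using (ℤ; +_)
open import Data.Integer.Divisibility as ℤD using ()
open import Data.Integer.GCD as ℤG using ()
open import Data.Rational as ℚ using (ℚ; 0ℚ; 1ℚ)
open import Data.Product using (Σ; ∃; _×_; _,_)
open import Data.Sum using (_⊎_)
open import Data.Unit using (⊤)
open import Relation.Binary.PropositionalEquality using (_≡_)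
open import Relation.Nullary using (¬_)

-- The monic cubic  p(x) = x^3 + a2 x^2 + a1 x + a0  ∈ ℤ[x]

record Cubic : Set where
  constructor cubic
  field
    a2 a1 a0 : ℤ
open Cubic public

ℤ→ℚ : ℤ → ℚ
ℤ→ℚ z = z ℚ./ 1

-- For a cubic the degrees must be 1 and 2.
-- f = b1 x + b0 (b1 ≠ 0), g = d2 x^2 + d1 x + d0 (d2 ≠ 0), and f g = p
-- coefficientwise.
Irreducible : Cubic → Set
Irreducible p =
  ¬ (Σ ℚ λ b1 → Σ ℚ λ b0 → Σ ℚ λ d2 → Σ ℚ λ d1 → Σ ℚ λ d0 →
       ¬ (b1 ≡ 0ℚ) × ¬ (d2 ≡ 0ℚ)
     × (b1 ℚ.* d2 ≡ 1ℚ)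
     × (b1 ℚ.* d1 ℚ.+ b0 ℚ.* d2 ≡ ℤ→ℚ (a2 p))
     × (b1 ℚ.* d0 ℚ.+ b0 ℚ.* d1 ≡ ℤ→ℚ (a1 p))
     × (b0 ℚ.* d0 ≡ ℤ→ℚ (a0 p)))

Even Odd : ℤ → Set
Even z = (+ 2) ℤD.∣ z
Odd z = ¬ Even z

-- The ring ℤ[θ], θ a root of p.  Since p is monic irreducible,
-- 1, θ, θ^2 is a ℤ-basis and ℤ[θ] ≅ ℤ[x]/(p); an element
-- c0 + c1 θ + c2 θ^2 is stored as its coordinate triple.

record Zθ : Set where
  constructor ⟨_,_,_⟩
  field
    c0 c1 c2 : ℤ
open Zθ public

addθ : Zθ → Zθ → Zθ
addθ x y = ⟨ c0 x ℤ.+ c0 y , c1 x ℤ.+ c1 y , c2 x ℤ.+ c2 y ⟩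

-- multiplication, reducing with θ^3 = -a2 θ^2 - a1 θ - a0 and
-- θ^4 = (a2^2 - a1) θ^2 + (a1 a2 - a0) θ + a2 a0
mulθ : Cubic → Zθ → Zθ → Zθ
mulθ p x y =
  ⟨ d0 ℤ.- a0 p ℤ.* d3 ℤ.+ a2 p ℤ.* a0 p ℤ.* d4
  , d1 ℤ.- a1 p ℤ.* d3 ℤ.+ (a1 p ℤ.* a2 p ℤ.- a0 p) ℤ.* d4
  , d2 ℤ.- a2 p ℤ.* d3 ℤ.+ (a2 p ℤ.* a2 p ℤ.- a1 p) ℤ.* d4 ⟩
  where
  d0 = c0 x ℤ.* c0 y
  d1 = c0 x ℤ.* c1 y ℤ.+ c1 x ℤ.* c0 y
  d2 = c0 x ℤ.* c2 y ℤ.+ c1 x ℤ.* c1 y ℤ.+ c2 x ℤ.* c0 y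
  d3 = c1 x ℤ.* c2 y ℤ.+ c2 x ℤ.* c1 y
  d4 = c2 x ℤ.* c2 y

embθ : ℤ → Zθ
embθ n = ⟨ n , + 0 , + 0 ⟩

θ : Zθ
θ = ⟨ + 0 , + 1 , + 0 ⟩

subθ : Zθ → Zθ → Zθ
subθ x y = ⟨ c0 x ℤ.- c0 y , c1 x ℤ.- c1 y , c2 x ℤ.- c2 y ⟩

Mθ : Zθ → ℕ
Mθ x = ℤ.∣ c0 x ∣ Data.Nat.⊔ ℤ.∣ c1 x ∣ Data.Nat.⊔ ℤ.∣ c2 x ∣
  where import Data.Nat

-- Bounds in [0, ∞] of the shape  r · X^(1/k)  (r, X ≥ 0 rationals, k ≥ 1)
-- or ∞.  "m ≤ r · X^(1/k)" for m ≥ 0 is decided by m^k ≤ r^k · X.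

powℚ : ℚ → ℕ → ℚ
powℚ r zero = 1ℚ
powℚ r (suc k) = r ℚ.* powℚ r k

data Bound : Set where
  _·_^1/_ : ℚ → ℚ → ℕ → Bound
  ∞ : Bound

_≤ᴮ_ : ℕ → Bound → Set
m ≤ᴮ (r · X ^1/ k) = powℚ (ℤ→ℚ (+ m)) k ℚ.≤ powℚ r k ℚ.* X
m ≤ᴮ ∞ = ⊤

sqθ : Cubic → Zθ → Zθ
sqθ p w = mulθ p w w

InR : Cubic → ℕ → Bound → Bound → Zθ × Zθ → Set
InR p q Y1 Y2 (ω1 , ω2) =
  (Mθ ω1 ≤ᴮ Y1) × (Mθ ω2 ≤ᴮ Y1) ×
  (Σ ℤ λ n → (ℤ.∣ n ∣ ≤ᴮ Y2) ×
     (addθ (sqθ p ω1) (sqθ p ω2)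
        ≡ mulθ p (embθ (+ (q Data.Nat.* q))) (subθ (embθ n) θ)))
  where import Data.Nat

I : ℤ → ℤ → ℤ → ℤ → ℤ
I u1 u2 v1 v2 = u1 ℤ.* v2 ℤ.- v1 ℤ.* u2

h1 : Cubic → ℤ → ℤ → ℤ → ℤ → ℤ
h1 p u1 u2 v1 v2 =
  ℤ.- (+ 1) ℤ.+ (+ 2) ℤ.* a1 p ℤ.* u1 ℤ.* u2
  ℤ.- u2 ℤ.* u2 ℤ.* (a1 p ℤ.* a2 p ℤ.- a0 p)
  ℤ.+ (+ 2) ℤ.* a1 p ℤ.* v1 ℤ.* v2
  ℤ.- v2 ℤ.* v2 ℤ.* (a1 p ℤ.* a2 p ℤ.- a0 p)

h2 : Cubic → ℤ → ℤ → ℤ → ℤ → ℤ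
h2 p u1 u2 v1 v2 =
  ℤ.- (u1 ℤ.* u1) ℤ.+ (+ 2) ℤ.* a2 p ℤ.* u1 ℤ.* u2
  ℤ.- u2 ℤ.* u2 ℤ.* (a2 p ℤ.* a2 p ℤ.- a1 p)
  ℤ.- v1 ℤ.* v1 ℤ.+ (+ 2) ℤ.* a2 p ℤ.* v1 ℤ.* v2
  ℤ.- v2 ℤ.* v2 ℤ.* (a2 p ℤ.* a2 p ℤ.- a1 p)

-- u0 = U0 = v2 h1/2 - v1 h2/2 and v0 = V0 = -u2 h1/2 + u1 h2/2,
-- stated without division as 2 u0 = v2 h1 - v1 h2, 2 v0 = -u2 h1 + u1 h2
-- (equivalent for integers u0, v0; under the constraints of S both h1
-- and h2 are even).
InS : Cubic → Zθ × Zθ → Set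
InS p (⟨ u0 , u1 , u2 ⟩ , ⟨ v0 , v1 , v2 ⟩) =
  Even v2 × (ℤG.gcd u2 v2 ≡ + 1) ×
  Odd u1 × Odd v1 × (I u1 u2 v1 v2 ≡ + 1) ×
  ((+ 2) ℤ.* u0 ≡ v2 ℤ.* H1 ℤ.- v1 ℤ.* H2) ×
  ((+ 2) ℤ.* v0 ≡ ℤ.- (u2 ℤ.* H1) ℤ.+ u1 ℤ.* H2)
  where
  H1 = h1 p u1 u2 v1 v2
  H2 = h2 p u1 u2 v1 v2

IsChoice : (ℤ → ℤ → ℤ) → (ℤ → ℤ → ℤ) → Set
IsChoice 𝐮 𝐯 = ∀ α β → ℤG.gcd α β ≡ + 1 → Even α →
  Odd (𝐮 α β) × Odd (𝐯 α β) × (𝐮 α β ℤ.* α ℤ.- 𝐯 α β ℤ.* β ≡ + 1)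

InSc : Cubic → (ℤ → ℤ → ℤ) → ℚ → ℤ → ℤ → ℚ → Zθ × Zθ → Set
InSc p 𝐯 c α β X (u , v) =
  InS p (u , v) × (c2 v ≡ α) × (c2 u ≡ β) ×
  (ℤ.∣ c1 v ∣ ≤ᴮ (c · X ^1/ 6)) ×
  (((+ 2) ℤ.* α) ℤD.∣ (c1 v ℤ.- 𝐯 α β))

-- Write ω₁ = u₀ + u₁θ + u₂θ² and ω₂ = v₀ + v₁θ + v₂θ². Reducing with p(θ) = 0, the θ- and
-- θ²-coordinates of ω₁² + ω₂² are u₁(2u₀) + v₁(2v₀) − h₁ − 1 and u₂(2u₀) + v₂(2v₀) − h₂.
-- On S the vector (2u₀, 2v₀) is the adjugate of M = (u₁ v₁ ; u₂ v₂) applied to (h₁, h₂), and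
-- det M = I = 1, so these coordinates are −1 and 0: ω₁² + ω₂² = n − θ.
-- For the size, u₁α − v₁β = 1 and β ≤ α give |u₁| ≤ |v₁| + 1, so u₁, u₂, v₁, v₂ are bounded by
-- n = α + |v₁| ≤ 2 max(α, |v₁|) ≤ 2cX^(1/6). Each hᵢ is, up to the constant −1, a fixed binary
-- quadratic form evaluated at (u₁, u₂) plus the same form at (v₁, v₂), so hᵢ = O(n²) and
-- u₀, v₀ = O(n³). Hence M_θ(ωᵢ) ≤ K n³ ≤ 8K c³ X^(1/2) with K depending only on p, and
-- F(c) = 8K c³.
module Submission where

open import Defs
open import Data.Integer as ℤ using (ℤ; +_)
open import Data.Integer.GCD using (gcd)
open import Data.Nat as ℕ using (ℕ; zero; suc; NonZero)
open import Data.Rational as ℚ using (ℚ; 0ℚ)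
open import Data.Product using (Σ; _×_; _,_; proj₁; proj₂)
open import Data.Sum using (inj₁; inj₂)
open import Data.Unit using (tt)
open import Relation.Binary.PropositionalEquality using (_≡_; refl; sym; trans; cong; subst; module ≡-Reasoning)

module _ where
  open import Data.Integer using (_+_; _*_; _-_; -_)
  open import Data.Integer.Properties using (+-identityʳ; +-inverseʳ; *-identityʳ)
  open import Data.Integer.Tactic.RingSolver using (solve-∀)
  open ≡-Reasoning

  Zθ-ext : ∀ {x y} → c0 x ≡ c0 y → c1 x ≡ c1 y → c2 x ≡ c2 y → x ≡ y
  Zθ-ext {⟨ _ , _ , _ ⟩} {⟨ _ , _ , _ ⟩} refl refl refl = refl

  mulθ-identityˡ : ∀ p x → mulθ p (embθ (+ 1)) x ≡ x
  mulθ-identityˡ p ⟨ x0 , x1 , x2 ⟩ =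
    Zθ-ext (e0 (a2 p) (a0 p) x0) (e1 (a2 p) (a1 p) (a0 p) x1) (e2 (a2 p) (a1 p) x2)
    where
    -- The ring solver does not unfold definitions, so here and below the identities are
    -- stated on the unfolded coordinates of mulθ, h1 and h2.
    e0 : ∀ A2 A0 x0 → (+ 1) * x0 - A0 * (+ 0) + A2 * A0 * (+ 0) ≡ x0
    e0 = solve-∀
    e1 : ∀ A2 A1 A0 x1 → (+ 1) * x1 + (+ 0) - A1 * (+ 0) + (A1 * A2 - A0) * (+ 0) ≡ x1
    e1 = solve-∀
    e2 : ∀ A2 A1 x2 → (+ 1) * x2 + (+ 0) + (+ 0) - A2 * (+ 0) + (A2 * A2 - A1) * (+ 0) ≡ x2
    e2 = solve-∀

  subθ-embθ-θ : ∀ n → subθ (embθ n) θ ≡ ⟨ n , - (+ 1) , + 0 ⟩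
  subθ-embθ-θ n = cong (λ m → ⟨ m , - (+ 1) , + 0 ⟩) (+-identityʳ n)

  sum-of-squares-c1 : ∀ p u0 u1 u2 v0 v1 v2 →
    c1 (addθ (sqθ p ⟨ u0 , u1 , u2 ⟩) (sqθ p ⟨ v0 , v1 , v2 ⟩))
      ≡ u1 * ((+ 2) * u0) + v1 * ((+ 2) * v0) - h1 p u1 u2 v1 v2 - (+ 1)
  sum-of-squares-c1 p = identity (a2 p) (a1 p) (a0 p)
    where
    identity : ∀ A2 A1 A0 u0 u1 u2 v0 v1 v2 →
      u0 * u1 + u1 * u0 - A1 * (u1 * u2 + u2 * u1) + (A1 * A2 - A0) * (u2 * u2)
      + (v0 * v1 + v1 * v0 - A1 * (v1 * v2 + v2 * v1) + (A1 * A2 - A0) * (v2 * v2))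
        ≡ u1 * ((+ 2) * u0) + v1 * ((+ 2) * v0)
          - (- (+ 1) + (+ 2) * A1 * u1 * u2 - u2 * u2 * (A1 * A2 - A0)
             + (+ 2) * A1 * v1 * v2 - v2 * v2 * (A1 * A2 - A0)) - (+ 1)
    identity = solve-∀

  sum-of-squares-c2 : ∀ p u0 u1 u2 v0 v1 v2 →
    c2 (addθ (sqθ p ⟨ u0 , u1 , u2 ⟩) (sqθ p ⟨ v0 , v1 , v2 ⟩))
      ≡ u2 * ((+ 2) * u0) + v2 * ((+ 2) * v0) - h2 p u1 u2 v1 v2
  sum-of-squares-c2 p = identity (a2 p) (a1 p)
    where
    identity : ∀ A2 A1 u0 u1 u2 v0 v1 v2 →
      u0 * u2 + u1 * u1 + u2 * u0 - A2 * (u1 * u2 + u2 * u1) + (A2 * A2 - A1) * (u2 * u2)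
      + (v0 * v2 + v1 * v1 + v2 * v0 - A2 * (v1 * v2 + v2 * v1) + (A2 * A2 - A1) * (v2 * v2))
        ≡ u2 * ((+ 2) * u0) + v2 * ((+ 2) * v0)
          - (- (u1 * u1) + (+ 2) * A2 * u1 * u2 - u2 * u2 * (A2 * A2 - A1)
             - v1 * v1 + (+ 2) * A2 * v1 * v2 - v2 * v2 * (A2 * A2 - A1))
    identity = solve-∀

  adjugate-identity : ∀ {x1 x2 y1 y2 s t} g h → I x1 x2 y1 y2 ≡ + 1 →
    s ≡ y2 * g - y1 * h → t ≡ - (x2 * g) + x1 * h →
    (x1 * s + y1 * t ≡ g) × (x2 * s + y2 * t ≡ h)
  adjugate-identity {x1 = x1} {x2} {y1 = y1} {y2} g h det≡1 refl refl =
    (begin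
      x1 * (y2 * g - y1 * h) + y1 * (- (x2 * g) + x1 * h) ≡⟨ row₁ x1 x2 y1 y2 g h ⟩
      g * I x1 x2 y1 y2                                   ≡⟨ cong (g *_) det≡1 ⟩
      g * (+ 1)                                           ≡⟨ *-identityʳ g ⟩
      g ∎) ,
    (begin
      x2 * (y2 * g - y1 * h) + y2 * (- (x2 * g) + x1 * h) ≡⟨ row₂ x1 x2 y1 y2 g h ⟩
      h * I x1 x2 y1 y2                                   ≡⟨ cong (h *_) det≡1 ⟩
      h * (+ 1)                                           ≡⟨ *-identityʳ h ⟩
      h ∎)
    where
    row₁ : ∀ x1 x2 y1 y2 g h → x1 * (y2 * g - y1 * h) + y1 * (- (x2 * g) + x1 * h) ≡ g * (x1 * y2 - y1 * x2)
    row₁ = solve-∀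
    row₂ : ∀ x1 x2 y1 y2 g h → x2 * (y2 * g - y1 * h) + y2 * (- (x2 * g) + x1 * h) ≡ h * (x1 * y2 - y1 * x2)
    row₂ = solve-∀

  InS⇒sum-of-squares : ∀ p u v → InS p (u , v) →
    let S = addθ (sqθ p u) (sqθ p v) in S ≡ subθ (embθ (c0 S)) θ
  InS⇒sum-of-squares p ⟨ u0 , u1 , u2 ⟩ ⟨ v0 , v1 , v2 ⟩ (_ , _ , _ , _ , det≡1 , 2u0≡ , 2v0≡) =
    trans (Zθ-ext refl c1≡ c2≡) (sym (subθ-embθ-θ (c0 S)))
    where
    S = addθ (sqθ p ⟨ u0 , u1 , u2 ⟩) (sqθ p ⟨ v0 , v1 , v2 ⟩)
    H1 = h1 p u1 u2 v1 v2
    H2 = h2 p u1 u2 v1 v2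
    adj = adjugate-identity {u1} {u2} {v1} {v2} H1 H2 det≡1 2u0≡ 2v0≡
    c1≡ : c1 S ≡ - (+ 1)
    c1≡ = begin
      c1 S                                                  ≡⟨ sum-of-squares-c1 p u0 u1 u2 v0 v1 v2 ⟩
      u1 * ((+ 2) * u0) + v1 * ((+ 2) * v0) - H1 - (+ 1)    ≡⟨ cong (λ s → s - H1 - (+ 1)) (proj₁ adj) ⟩
      H1 - H1 - (+ 1)                                       ≡⟨ cong (_- (+ 1)) (+-inverseʳ H1) ⟩
      - (+ 1)                                               ∎
    c2≡ : c2 S ≡ + 0
    c2≡ = begin
      c2 S                                                  ≡⟨ sum-of-squares-c2 p u0 u1 u2 v0 v1 v2 ⟩
      u2 * ((+ 2) * u0) + v2 * ((+ 2) * v0) - H2            ≡⟨ cong (_- H2) (proj₂ adj) ⟩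
      H2 - H2                                               ≡⟨ +-inverseʳ H2 ⟩
      + 0                                                   ∎

  i-j≡k⇒i≡k+j : ∀ i j {k} → i - j ≡ k → i ≡ k + j
  i-j≡k⇒i≡k+j i j refl = identity i j
    where
    identity : ∀ i j → i ≡ i - j + j
    identity = solve-∀

  quadratic : ℤ × ℤ × ℤ → ℤ → ℤ → ℤ
  quadratic (a , b , c) x y = a * (x * x) + b * (x * y) + c * (y * y)

  form₁ form₂ : Cubic → ℤ × ℤ × ℤ
  form₁ p = + 0 , (+ 2) * a1 p , - (a1 p * a2 p - a0 p)
  form₂ p = - (+ 1) , (+ 2) * a2 p , - (a2 p * a2 p - a1 p)

  h1-as-forms : ∀ p u1 u2 v1 v2 →
    h1 p u1 u2 v1 v2 ≡ - (+ 1) + (quadratic (form₁ p) u1 u2 + quadratic (form₁ p) v1 v2)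
  h1-as-forms p = identity (a2 p) (a1 p) (a0 p)
    where
    identity : ∀ A2 A1 A0 u1 u2 v1 v2 →
      - (+ 1) + (+ 2) * A1 * u1 * u2 - u2 * u2 * (A1 * A2 - A0)
        + (+ 2) * A1 * v1 * v2 - v2 * v2 * (A1 * A2 - A0)
      ≡ - (+ 1)
        + ((+ 0) * (u1 * u1) + (+ 2) * A1 * (u1 * u2) + - (A1 * A2 - A0) * (u2 * u2)
          + ((+ 0) * (v1 * v1) + (+ 2) * A1 * (v1 * v2) + - (A1 * A2 - A0) * (v2 * v2)))
    identity = solve-∀

  h2-as-forms : ∀ p u1 u2 v1 v2 →
    h2 p u1 u2 v1 v2 ≡ quadratic (form₂ p) u1 u2 + quadratic (form₂ p) v1 v2
  h2-as-forms p = identity (a2 p) (a1 p)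
    where
    identity : ∀ A2 A1 u1 u2 v1 v2 →
      - (u1 * u1) + (+ 2) * A2 * u1 * u2 - u2 * u2 * (A2 * A2 - A1)
        - v1 * v1 + (+ 2) * A2 * v1 * v2 - v2 * v2 * (A2 * A2 - A1)
      ≡ - (+ 1) * (u1 * u1) + (+ 2) * A2 * (u1 * u2) + - (A2 * A2 - A1) * (u2 * u2)
        + (- (+ 1) * (v1 * v1) + (+ 2) * A2 * (v1 * v2) + - (A2 * A2 - A1) * (v2 * v2))
    identity = solve-∀

module _ where
  open import Data.Nat
  open import Data.Nat.Properties
  open import Data.Nat.Tactic.RingSolver using (solve-∀)
  open import Data.Integer.Properties using (∣i+j∣≤∣i∣+∣j∣; ∣i-j∣≤∣i∣+∣j∣; ∣i*j∣≡∣i∣*∣j∣; ∣-i∣≡∣i∣)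
  open ≤-Reasoning

  ∣i+j∣≤m+n : ∀ i j {m n} → ℤ.∣ i ∣ ≤ m → ℤ.∣ j ∣ ≤ n → ℤ.∣ i ℤ.+ j ∣ ≤ m + n
  ∣i+j∣≤m+n i j i≤m j≤n = ≤-trans (∣i+j∣≤∣i∣+∣j∣ i j) (+-mono-≤ i≤m j≤n)

  ∣i-j∣≤m+n : ∀ i j {m n} → ℤ.∣ i ∣ ≤ m → ℤ.∣ j ∣ ≤ n → ℤ.∣ i ℤ.- j ∣ ≤ m + n
  ∣i-j∣≤m+n i j i≤m j≤n = ≤-trans (∣i-j∣≤∣i∣+∣j∣ i j) (+-mono-≤ i≤m j≤n)

  ∣i*j∣≤m*n : ∀ i j {m n} → ℤ.∣ i ∣ ≤ m → ℤ.∣ j ∣ ≤ n → ℤ.∣ i ℤ.* j ∣ ≤ m * n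
  ∣i*j∣≤m*n i j i≤m j≤n = subst (_≤ _) (sym (∣i*j∣≡∣i∣*∣j∣ i j)) (*-mono-≤ i≤m j≤n)

  ∣-i∣≤n : ∀ i {n} → ℤ.∣ i ∣ ≤ n → ℤ.∣ ℤ.- i ∣ ≤ n
  ∣-i∣≤n i = subst (_≤ _) (sym (∣-i∣≡∣i∣ i))

  2i≡j⇒∣i∣≤∣j∣ : ∀ {i j} → (+ 2) ℤ.* i ≡ j → ℤ.∣ i ∣ ≤ ℤ.∣ j ∣
  2i≡j⇒∣i∣≤∣j∣ {i} refl = subst (ℤ.∣ i ∣ ≤_) (sym (∣i*j∣≡∣i∣*∣j∣ (+ 2) i)) (m≤n*m ℤ.∣ i ∣ 2)

  n≤k*n^3 : ∀ k n .{{_ : NonZero k}} → n ≤ k * n ^ 3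
  n≤k*n^3 k zero      = z≤n
  n≤k*n^3 k n@(suc _) = ≤-trans (m≤m*n n (n ^ 2)) (m≤n*m (n ^ 3) k)

  ∣u∣≤1+∣v∣ : ∀ u v a b .{{_ : NonZero ℤ.∣ a ∣}} →
    u ℤ.* a ℤ.- v ℤ.* b ≡ + 1 → ℤ.∣ b ∣ ≤ ℤ.∣ a ∣ → ℤ.∣ u ∣ ≤ suc ℤ.∣ v ∣
  ∣u∣≤1+∣v∣ u v a b det≡1 ∣b∣≤∣a∣ = *-cancelʳ-≤ ℤ.∣ u ∣ (suc ℤ.∣ v ∣) ℤ.∣ a ∣ (begin
    ℤ.∣ u ∣ * ℤ.∣ a ∣         ≡⟨ ∣i*j∣≡∣i∣*∣j∣ u a ⟨
    ℤ.∣ u ℤ.* a ∣             ≡⟨ cong ℤ.∣_∣ (i-j≡k⇒i≡k+j (u ℤ.* a) (v ℤ.* b) det≡1) ⟩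
    ℤ.∣ + 1 ℤ.+ v ℤ.* b ∣     ≤⟨ ∣i+j∣≤m+n (+ 1) (v ℤ.* b) ≤-refl (∣i*j∣≤m*n v b ≤-refl ∣b∣≤∣a∣) ⟩
    1 + ℤ.∣ v ∣ * ℤ.∣ a ∣     ≤⟨ +-monoˡ-≤ (ℤ.∣ v ∣ * ℤ.∣ a ∣) (>-nonZero⁻¹ ℤ.∣ a ∣) ⟩
    suc ℤ.∣ v ∣ * ℤ.∣ a ∣     ∎)

  k*[m+n]^3≤8*k*[m⊔n]^3 : ∀ k m n → k * (m + n) ^ 3 ≤ 8 * k * (m ⊔ n) ^ 3
  k*[m+n]^3≤8*k*[m⊔n]^3 k m n = begin
    k * (m + n) ^ 3           ≤⟨ *-monoʳ-≤ k (^-monoˡ-≤ 3 (+-mono-≤ (m≤m⊔n m n) (m≤n⊔m m n))) ⟩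
    k * ((m ⊔ n) + (m ⊔ n)) ^ 3 ≡⟨ eightfold k (m ⊔ n) ⟩
    8 * k * (m ⊔ n) ^ 3       ∎
    where
    eightfold : ∀ k M → k * ((M + M) * ((M + M) * ((M + M) * 1))) ≡ 8 * k * (M * (M * (M * 1)))
    eightfold = solve-∀

  height : ℤ × ℤ × ℤ → ℕ
  height (a , b , c) = ℤ.∣ a ∣ + ℤ.∣ b ∣ + ℤ.∣ c ∣

  ∣quadratic∣≤ : ∀ f x y n → ℤ.∣ x ∣ ≤ n → ℤ.∣ y ∣ ≤ n → ℤ.∣ quadratic f x y ∣ ≤ height f * (n * n)
  ∣quadratic∣≤ (a , b , c) x y n x≤n y≤n =
    ≤-trans (∣i+j∣≤m+n (ax² ℤ.+ bxy) cy² (∣i+j∣≤m+n ax² bxy (term a x x x≤n x≤n) (term b x y x≤n y≤n))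
                                         (term c y y y≤n y≤n))
            (≤-reflexive (distrib ℤ.∣ a ∣ ℤ.∣ b ∣ ℤ.∣ c ∣ (n * n)))
    where
    ax² = a ℤ.* (x ℤ.* x)
    bxy = b ℤ.* (x ℤ.* y)
    cy² = c ℤ.* (y ℤ.* y)
    term : ∀ k x y → ℤ.∣ x ∣ ≤ n → ℤ.∣ y ∣ ≤ n → ℤ.∣ k ℤ.* (x ℤ.* y) ∣ ≤ ℤ.∣ k ∣ * (n * n)
    term k x y x≤n y≤n = ∣i*j∣≤m*n k (x ℤ.* y) ≤-refl (∣i*j∣≤m*n x y x≤n y≤n)
    distrib : ∀ a b c m → a * m + b * m + c * m ≡ (a + b + c) * m
    distrib = solve-∀

  ∣quadratic+quadratic∣≤ : ∀ f x1 x2 y1 y2 n →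
    ℤ.∣ x1 ∣ ≤ n → ℤ.∣ x2 ∣ ≤ n → ℤ.∣ y1 ∣ ≤ n → ℤ.∣ y2 ∣ ≤ n →
    ℤ.∣ quadratic f x1 x2 ℤ.+ quadratic f y1 y2 ∣ ≤ 2 * height f * (n * n)
  ∣quadratic+quadratic∣≤ f x1 x2 y1 y2 n x1≤n x2≤n y1≤n y2≤n =
    ≤-trans (∣i+j∣≤m+n (quadratic f x1 x2) (quadratic f y1 y2)
              (∣quadratic∣≤ f x1 x2 n x1≤n x2≤n) (∣quadratic∣≤ f y1 y2 n y1≤n y2≤n))
            (≤-reflexive (double (height f) (n * n)))
    where
    double : ∀ h m → h * m + h * m ≡ 2 * h * m
    double = solve-∀

  κ₁ κ₂ K : Cubic → ℕ
  κ₁ p = 1 + 2 * height (form₁ p)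
  κ₂ p = 2 * height (form₂ p)
  K p = κ₁ p + κ₂ p

  Mθ≤ : ∀ x {m} → ℤ.∣ c0 x ∣ ≤ m → ℤ.∣ c1 x ∣ ≤ m → ℤ.∣ c2 x ∣ ≤ m → Mθ x ≤ m
  Mθ≤ _ c0≤m c1≤m c2≤m = ⊔-lub (⊔-lub c0≤m c1≤m) c2≤m

  module CoordinateBounds (p : Cubic) (u1 u2 v1 v2 : ℤ) {n : ℕ} (1≤n : 1 ≤ n)
    (u1≤n : ℤ.∣ u1 ∣ ≤ n) (u2≤n : ℤ.∣ u2 ∣ ≤ n) (v1≤n : ℤ.∣ v1 ∣ ≤ n) (v2≤n : ℤ.∣ v2 ∣ ≤ n) where

    H1 H2 : ℤ
    H1 = h1 p u1 u2 v1 v2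
    H2 = h2 p u1 u2 v1 v2

    ∣h1∣≤ : ℤ.∣ H1 ∣ ≤ κ₁ p * (n * n)
    ∣h1∣≤ = subst (λ h → ℤ.∣ h ∣ ≤ _) (sym (h1-as-forms p u1 u2 v1 v2))
      (∣i+j∣≤m+n (ℤ.- (+ 1)) (quadratic (form₁ p) u1 u2 ℤ.+ quadratic (form₁ p) v1 v2) (*-mono-≤ 1≤n 1≤n)
        (∣quadratic+quadratic∣≤ (form₁ p) u1 u2 v1 v2 n u1≤n u2≤n v1≤n v2≤n))

    ∣h2∣≤ : ℤ.∣ H2 ∣ ≤ κ₂ p * (n * n)
    ∣h2∣≤ = subst (λ h → ℤ.∣ h ∣ ≤ _) (sym (h2-as-forms p u1 u2 v1 v2))
      (∣quadratic+quadratic∣≤ (form₂ p) u1 u2 v1 v2 n u1≤n u2≤n v1≤n v2≤n)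

    private
      ≤n⇒≤Kn³ : ∀ {m} → m ≤ n → m ≤ K p * n ^ 3
      ≤n⇒≤Kn³ m≤n = ≤-trans m≤n (n≤k*n^3 (K p) n)

      ≡Kn³ : n * (κ₁ p * (n * n)) + n * (κ₂ p * (n * n)) ≡ K p * n ^ 3
      ≡Kn³ = collect n (κ₁ p) (κ₂ p)
        where
        collect : ∀ n a b → n * (a * (n * n)) + n * (b * (n * n)) ≡ (a + b) * (n * (n * (n * 1)))
        collect = solve-∀

    Mθ-u≤ : ∀ u0 → (+ 2) ℤ.* u0 ≡ v2 ℤ.* H1 ℤ.- v1 ℤ.* H2 → Mθ ⟨ u0 , u1 , u2 ⟩ ≤ K p * n ^ 3
    Mθ-u≤ u0 2u0≡ = Mθ≤ ⟨ u0 , u1 , u2 ⟩ ∣u0∣≤ (≤n⇒≤Kn³ u1≤n) (≤n⇒≤Kn³ u2≤n)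
      where
      ∣u0∣≤ = begin
        ℤ.∣ u0 ∣                          ≤⟨ 2i≡j⇒∣i∣≤∣j∣ 2u0≡ ⟩
        ℤ.∣ v2 ℤ.* H1 ℤ.- v1 ℤ.* H2 ∣     ≤⟨ ∣i-j∣≤m+n (v2 ℤ.* H1) (v1 ℤ.* H2)
                                               (∣i*j∣≤m*n v2 H1 v2≤n ∣h1∣≤) (∣i*j∣≤m*n v1 H2 v1≤n ∣h2∣≤) ⟩
        n * (κ₁ p * (n * n)) + n * (κ₂ p * (n * n)) ≡⟨ ≡Kn³ ⟩
        K p * n ^ 3                       ∎

    Mθ-v≤ : ∀ v0 → (+ 2) ℤ.* v0 ≡ ℤ.- (u2 ℤ.* H1) ℤ.+ u1 ℤ.* H2 → Mθ ⟨ v0 , v1 , v2 ⟩ ≤ K p * n ^ 3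
    Mθ-v≤ v0 2v0≡ = Mθ≤ ⟨ v0 , v1 , v2 ⟩ ∣v0∣≤ (≤n⇒≤Kn³ v1≤n) (≤n⇒≤Kn³ v2≤n)
      where
      ∣v0∣≤ = begin
        ℤ.∣ v0 ∣                          ≤⟨ 2i≡j⇒∣i∣≤∣j∣ 2v0≡ ⟩
        ℤ.∣ ℤ.- (u2 ℤ.* H1) ℤ.+ u1 ℤ.* H2 ∣ ≤⟨ ∣i+j∣≤m+n (ℤ.- (u2 ℤ.* H1)) (u1 ℤ.* H2)
                                               (∣-i∣≤n (u2 ℤ.* H1) (∣i*j∣≤m*n u2 H1 u2≤n ∣h1∣≤))
                                               (∣i*j∣≤m*n u1 H2 u1≤n ∣h2∣≤) ⟩
        n * (κ₁ p * (n * n)) + n * (κ₂ p * (n * n)) ≡⟨ ≡Kn³ ⟩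
        K p * n ^ 3                       ∎

module _ where
  import Data.Nat.Properties as ℕP
  open import Data.Nat.Tactic.RingSolver using (solve-∀)
  import Data.Integer.Properties as ℤP
  open import Data.Rational using (_*_; _≤_; _<_; 1ℚ; Positive; NonNegative; _⊓_; 1/_; positive; nonNegative; toℚᵘ)
  open import Data.Rational.Properties
  import Data.Rational.Unnormalised as ℚᵘ
  import Data.Rational.Unnormalised.Properties as ℚᵘ
  open import Data.Rational.Solver using (module +-*-Solver)

  ℕ→ℚ : ℕ → ℚ
  ℕ→ℚ m = ℤ→ℚ (+ m)

  ℕ→ℚ-nonNeg : ∀ n → NonNegative (ℕ→ℚ n)
  ℕ→ℚ-nonNeg n = normalize-nonNeg n 1

  ℕ→ℚ-pos : ∀ n .{{_ : NonZero n}} → Positive (ℕ→ℚ n)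
  ℕ→ℚ-pos n = normalize-pos n 1

  toℚᵘ-ℕ→ℚ : ∀ m → toℚᵘ (ℕ→ℚ m) ℚᵘ.≃ ℚᵘ.mkℚᵘ (+ m) 0
  toℚᵘ-ℕ→ℚ m = toℚᵘ-fromℚᵘ (ℚᵘ.mkℚᵘ (+ m) 0)

  ℕ→ℚ-homo-* : ∀ m n → ℕ→ℚ (m ℕ.* n) ≡ ℕ→ℚ m * ℕ→ℚ n
  ℕ→ℚ-homo-* m n = toℚᵘ-injective (begin
    toℚᵘ (ℕ→ℚ (m ℕ.* n))                       ≈⟨ toℚᵘ-ℕ→ℚ (m ℕ.* n) ⟩
    ℚᵘ.mkℚᵘ (+ (m ℕ.* n)) 0                     ≈⟨ ℚᵘ.*≡* (cong (ℤ._* + 1) (ℤP.pos-* m n)) ⟩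
    ℚᵘ.mkℚᵘ (+ m) 0 ℚᵘ.* ℚᵘ.mkℚᵘ (+ n) 0        ≈⟨ ℚᵘ.*-cong (toℚᵘ-ℕ→ℚ m) (toℚᵘ-ℕ→ℚ n) ⟨
    toℚᵘ (ℕ→ℚ m) ℚᵘ.* toℚᵘ (ℕ→ℚ n)             ≈⟨ toℚᵘ-homo-* (ℕ→ℚ m) (ℕ→ℚ n) ⟨
    toℚᵘ (ℕ→ℚ m * ℕ→ℚ n)                       ∎)
    where open ℚᵘ.≃-Reasoning

  ℕ→ℚ-mono-≤ : ∀ {m n} → m ℕ.≤ n → ℕ→ℚ m ≤ ℕ→ℚ n
  ℕ→ℚ-mono-≤ {m} {n} m≤n = toℚᵘ-cancel-≤
    (ℚᵘ.≤-respʳ-≃ (ℚᵘ.≃-sym (toℚᵘ-ℕ→ℚ n)) (ℚᵘ.≤-respˡ-≃ (ℚᵘ.≃-sym (toℚᵘ-ℕ→ℚ m))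
      (ℚᵘ.*≤* (ℤP.*-monoʳ-≤-nonNeg (+ 1) (ℤ.+≤+ m≤n)))))

  ℕ→ℚ-homo-^ : ∀ m n → powℚ (ℕ→ℚ m) n ≡ ℕ→ℚ (m ℕ.^ n)
  ℕ→ℚ-homo-^ m zero    = refl
  ℕ→ℚ-homo-^ m (suc n) = trans (cong (ℕ→ℚ m *_) (ℕ→ℚ-homo-^ m n)) (sym (ℕ→ℚ-homo-* m (m ℕ.^ n)))

  ⊔-≤ᴮ : ∀ m n B → m ≤ᴮ B → n ≤ᴮ B → (m ℕ.⊔ n) ≤ᴮ B
  ⊔-≤ᴮ m n B m≤B n≤B with ℕP.⊔-sel m n
  ... | inj₁ m⊔n≡m rewrite m⊔n≡m = m≤B
  ... | inj₂ m⊔n≡n rewrite m⊔n≡n = n≤B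

  ≤ᴮ-cube : ∀ {m k M c X} → m ℕ.≤ k ℕ.* M ℕ.^ 3 → M ≤ᴮ (c · X ^1/ 6) →
    m ≤ᴮ ((ℕ→ℚ k * powℚ c 3) · X ^1/ 2)
  ≤ᴮ-cube {m} {k} {M} {c} {X} m≤kM³ M≤ = begin
    powℚ (ℕ→ℚ m) 2                      ≡⟨ ℕ→ℚ-homo-^ m 2 ⟩
    ℕ→ℚ (m ℕ.^ 2)                       ≤⟨ ℕ→ℚ-mono-≤ (ℕP.^-monoˡ-≤ 2 m≤kM³) ⟩
    ℕ→ℚ ((k ℕ.* M ℕ.^ 3) ℕ.^ 2)         ≡⟨ cong ℕ→ℚ (square-cube k M) ⟩
    ℕ→ℚ (k ℕ.^ 2 ℕ.* M ℕ.^ 6)           ≡⟨ ℕ→ℚ-homo-* (k ℕ.^ 2) (M ℕ.^ 6) ⟩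
    ℕ→ℚ (k ℕ.^ 2) * ℕ→ℚ (M ℕ.^ 6)       ≤⟨ *-monoˡ-≤-nonNeg (ℕ→ℚ (k ℕ.^ 2)) {{ℕ→ℚ-nonNeg (k ℕ.^ 2)}}
                                              (subst (_≤ _) (ℕ→ℚ-homo-^ M 6) M≤) ⟩
    ℕ→ℚ (k ℕ.^ 2) * (powℚ c 6 * X)      ≡⟨ cong (_* (powℚ c 6 * X)) (ℕ→ℚ-homo-^ k 2) ⟨
    powℚ (ℕ→ℚ k) 2 * (powℚ c 6 * X)     ≡⟨ regroup (ℕ→ℚ k) c X ⟩
    powℚ (ℕ→ℚ k * powℚ c 3) 2 * X       ∎
    where
    open ≤-Reasoning
    square-cube : ∀ k M → k ℕ.* (M ℕ.* (M ℕ.* (M ℕ.* 1))) ℕ.* ((k ℕ.* (M ℕ.* (M ℕ.* (M ℕ.* 1)))) ℕ.* 1)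
                        ≡ k ℕ.* (k ℕ.* 1) ℕ.* (M ℕ.* (M ℕ.* (M ℕ.* (M ℕ.* (M ℕ.* (M ℕ.* 1))))))
    square-cube = solve-∀
    regroup : ∀ a c x → powℚ a 2 * (powℚ c 6 * x) ≡ powℚ (a * powℚ c 3) 2 * x
    regroup = solve 3 (λ a c x → (a :^ 2) :* ((c :^ 6) :* x) := ((a :* (c :^ 3)) :^ 2) :* x) refl
      where open +-*-Solver

  powℚ-pos : ∀ {c} n → 0ℚ < c → 0ℚ < powℚ c n
  powℚ-pos zero    _   = positive⁻¹ 1ℚ
  powℚ-pos {c} (suc n) 0<c =
    positive⁻¹ (c * powℚ c n) {{pos*pos⇒pos c {{positive 0<c}} (powℚ c n) {{positive (powℚ-pos n 0<c)}}}}

  powℚ≤1 : ∀ {c} n → 0ℚ ≤ c → c ≤ 1ℚ → powℚ c n ≤ 1ℚ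
  powℚ≤1 zero    _   _   = ≤-refl
  powℚ≤1 {c} (suc n) 0≤c c≤1 = begin
    c * powℚ c n   ≤⟨ *-monoˡ-≤-nonNeg c {{nonNegative 0≤c}} (powℚ≤1 n 0≤c c≤1) ⟩
    c * 1ℚ         ≡⟨ *-identityʳ c ⟩
    c              ≤⟨ c≤1 ⟩
    1ℚ             ∎
    where open ≤-Reasoning

  *-cube-pos : ∀ C .{{_ : Positive C}} {c} → 0ℚ < c → 0ℚ < C * powℚ c 3
  *-cube-pos C {c} 0<c = positive⁻¹ (C * powℚ c 3) {{pos*pos⇒pos C (powℚ c 3) {{positive (powℚ-pos 3 0<c)}}}}

  *-cube→0 : ∀ C .{{_ : Positive C}} ε → 0ℚ < ε →
    Σ ℚ λ δ → 0ℚ < δ × (∀ c → 0ℚ < c → c < δ → C * powℚ c 3 < ε)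
  *-cube→0 C ε 0<ε = δ , 0<δ , C*c³<ε
    where
    instance
      C≢0 : ℚ.NonZero C
      C≢0 = pos⇒nonZero C
    e = ε * 1/ C
    0<e : 0ℚ < e
    0<e = positive⁻¹ e {{pos*pos⇒pos ε {{positive 0<ε}} (1/ C) {{1/pos⇒pos C}}}}
    C*e≡ε : C * e ≡ ε
    C*e≡ε = begin
      C * (ε * 1/ C)   ≡⟨ cong (C *_) (*-comm ε (1/ C)) ⟩
      C * (1/ C * ε)   ≡⟨ *-assoc C (1/ C) ε ⟨
      C * 1/ C * ε     ≡⟨ cong (_* ε) (*-inverseʳ C) ⟩
      1ℚ * ε           ≡⟨ *-identityˡ ε ⟩
      ε                ∎
      where open ≡-Reasoning
    δ = e ⊓ 1ℚ
    0<δ : 0ℚ < δ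
    0<δ with ⊓-sel e 1ℚ
    ... | inj₁ δ≡e = subst (0ℚ <_) (sym δ≡e) 0<e
    ... | inj₂ δ≡1 = subst (0ℚ <_) (sym δ≡1) (positive⁻¹ 1ℚ)
    C*c³<ε : ∀ c → 0ℚ < c → c < δ → C * powℚ c 3 < ε
    C*c³<ε c 0<c c<δ = begin-strict
      C * powℚ c 3    ≤⟨ *-monoˡ-≤-nonNeg C {{pos⇒nonNeg C}} c³≤c ⟩
      C * c           <⟨ *-monoʳ-<-pos C (<-≤-trans c<δ (p⊓q≤p e 1ℚ)) ⟩
      C * e           ≡⟨ C*e≡ε ⟩
      ε               ∎
      where
      open ≤-Reasoning
      0≤c = <⇒≤ 0<c
      c³≤c : powℚ c 3 ≤ c
      c³≤c = ≤-trans (*-monoˡ-≤-nonNeg c {{nonNegative 0≤c}} (powℚ≤1 2 0≤c (<⇒≤ (<-≤-trans c<δ (p⊓q≤q e 1ℚ)))))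
                     (≤-reflexive (*-identityʳ c))

F : Cubic → ℚ → ℚ
F p c = ℕ→ℚ (8 ℕ.* K p) ℚ.* powℚ c 3

module _ where
  open import Data.Nat using (z≤n; s≤s; _≤_; _+_; _*_; _⊔_; _^_)
  open import Data.Nat.Properties using (≤-trans; m≤m+n; m≤n+m)

  Sc⊆R : ∀ p 𝐯 c X {α β} → + 1 ℤ.≤ β → β ℤ.≤ α → ℤ.∣ α ∣ ≤ᴮ (c · X ^1/ 6) →
    ∀ w → InSc p 𝐯 c α β X w → InR p 1 (F p c · X ^1/ 2) ∞ w
  Sc⊆R p 𝐯 c X (ℤ.+≤+ (s≤s z≤n)) (ℤ.+≤+ (s≤s {b} {a} b≤a)) α≤ᴮ
    (⟨ u0 , u1 , _ ⟩ , ⟨ v0 , v1 , _ ⟩) (inS@(_ , _ , _ , _ , det≡1 , 2u0≡ , 2v0≡) , refl , refl , v1≤ᴮ , _) =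
    cube-bound (Mθ-u≤ u0 2u0≡) , cube-bound (Mθ-v≤ v0 2v0≡) ,
    (c0 S , tt , trans (InS⇒sum-of-squares p u v inS) (sym (mulθ-identityˡ p (subθ (embθ (c0 S)) θ))))
    where
    u = ⟨ u0 , u1 , + suc b ⟩
    v = ⟨ v0 , v1 , + suc a ⟩
    S = addθ (sqθ p u) (sqθ p v)
    n = suc a + ℤ.∣ v1 ∣
    u1≤n : ℤ.∣ u1 ∣ ≤ n
    u1≤n = ≤-trans (∣u∣≤1+∣v∣ u1 v1 (+ suc a) (+ suc b) det≡1 (s≤s b≤a)) (s≤s (m≤n+m ℤ.∣ v1 ∣ a))
    open CoordinateBounds p u1 (+ suc b) v1 (+ suc a) (s≤s z≤n)
      u1≤n (≤-trans (s≤s b≤a) (m≤m+n (suc a) ℤ.∣ v1 ∣)) (m≤n+m ℤ.∣ v1 ∣ (suc a)) (m≤m+n (suc a) ℤ.∣ v1 ∣)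
    cube-bound : ∀ {m} → m ≤ K p * n ^ 3 → m ≤ᴮ (F p c · X ^1/ 2)
    cube-bound m≤ = ≤ᴮ-cube {k = 8 * K p} {M = suc a ⊔ ℤ.∣ v1 ∣} {c} {X}
      (≤-trans m≤ (k*[m+n]^3≤8*k*[m⊔n]^3 (K p) (suc a) ℤ.∣ v1 ∣))
      (⊔-≤ᴮ (suc a) ℤ.∣ v1 ∣ (c · X ^1/ 6) α≤ᴮ v1≤ᴮ)

lemma4p3 : (p : Cubic) → Irreducible p →
    Even (a2 p ℤ.* a2 p ℤ.- a1 p) → Odd (a1 p ℤ.* a2 p ℤ.- a0 p) →
    (𝐮 𝐯 : ℤ → ℤ → ℤ) → IsChoice 𝐮 𝐯 →
    Σ (ℚ → ℚ) λ F →
      (∀ c → 0ℚ ℚ.< c → 0ℚ ℚ.< F c) ×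
      (∀ ε → 0ℚ ℚ.< ε → Σ ℚ λ δ → 0ℚ ℚ.< δ × (∀ c → 0ℚ ℚ.< c → c ℚ.< δ → F c ℚ.< ε)) ×
      (∀ c → 0ℚ ℚ.< c → Σ ℚ λ N → ∀ X → N ℚ.≤ X → 0ℚ ℚ.< X →
        ∀ α β → gcd α β ≡ + 1 → Even α →
        + 1 ℤ.≤ β → β ℤ.≤ α → ℤ.∣ α ∣ ≤ᴮ (c · X ^1/ 6) →
        ∀ w → InSc p 𝐯 c α β X w → InR p 1 (F c · X ^1/ 2) ∞ w)
lemma4p3 p _ _ _ _ 𝐯 _ =
  F p ,
  (λ c → *-cube-pos C {c}) ,
  *-cube→0 C ,
  λ c _ → 0ℚ , λ X _ _ _ _ _ _ → Sc⊆R p 𝐯 c X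
  where
  C = ℕ→ℚ (8 ℕ.* K p)
  instance
    C-pos : ℚ.Positive C
    C-pos = ℕ→ℚ-pos (8 ℕ.* K p)
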